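{- Let $E$ be a finite set carrying a matroid structure, and let $\unlhd$ and $\unlhd'$ be two linear orders on $E$; let $M$ and $M'$ denote the corresponding ordered matroids. Suppose that $\mathrm{Act}_M(E)=\mathrm{Act}_{M'}(E)$ and that $\unlhd$ and $\unlhd'$ agree when restricted to this set. Then $L(M)\cong L(M')$ as lattices; in fact, the identity map on the common set of bases $\mathcal B(M)=\mathcal B(M')$ (together with $\hat0\mapsto\hat0$) is a lattice isomorphism.
   Context: An ordered matroid is a matroid on a finite set $E$ together with a linear order on $E$; $\mathcal B(M)$ is its set of bases. For $F\subseteq E$, an element $e\in E$ is active with respect to $F$ if there is a circuit $C\subseteq F\cup\{e\}$ of $M$ with $e\in C$ and $e$ the minimum element of $C$ in the order; $\mathrm{Act}_M(F)$ is the set of such $e$ (including possibly $e\in F$), and $\mathrm{Ext}_M(F)=\mathrm{Act}_M(F)\setminus F$. The external order on $\mathcal B(M)$ is: $A\le_M B$ iff $A\subseteq B\cup\mathrm{Ext}_M(B)$. $L(M)$ denotes $\mathcal B(M)$ with this order and a new minimum element $\hat0$ adjoined (this is a lattice). -}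

module Defs where

open import Data.Nat using (ℕ; _<_)
open import Data.Fin using (Fin)
open import Data.Fin.Subset using (Subset; _∈_; _∉_; _⊆_; _⊂_; _∪_; _─_; ⁅_⁆; ⊥; ∣_∣)
open import Data.Product using (Σ; ∃; _×_; _,_)
open import Data.Sum using (_⊎_)
open import Data.Maybe using (Maybe; just; nothing)
open import Data.Unit using (⊤)
open import Relation.Nullary using (¬_)
open import Relation.Binary.PropositionalEquality using (_≡_)
open import Relation.Binary.Structures using (IsTotalOrder)
import Data.Empty as Empty

record Matroid (n : ℕ) : Set₁ where
  field
    Indep       : Subset n → Set
    indep-empty : Indep ⊥
    indep-down  : ∀ {I J} → J ⊆ I → Indep I → Indep J
    indep-aug   : ∀ {I J} → Indep I → Indep J → ∣ I ∣ < ∣ J ∣ →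
                  ∃ λ e → e ∈ J × e ∉ I × Indep (I ∪ ⁅ e ⁆)

module _ {n : ℕ} (M : Matroid n) where
  open Matroid M

  IsCircuit : Subset n → Set
  IsCircuit C = ¬ Indep C × (∀ D → D ⊂ C → Indep D)

  IsBasis : Subset n → Set
  IsBasis B = Indep B × (∀ J → Indep J → B ⊆ J → J ⊆ B)

record LinOrder (n : ℕ) : Set₁ where
  field
    _⊴_         : Fin n → Fin n → Set
    isTotalOrder : IsTotalOrder _≡_ _⊴_

module _ {n : ℕ} (M : Matroid n) (O : LinOrder n) where
  open LinOrder O

  IsMinOf : Fin n → Subset n → Set
  IsMinOf e C = e ∈ C × (∀ f → f ∈ C → e ⊴ f)

  Act : Subset n → Fin n → Set
  Act F e = Σ (Subset n) λ C → IsCircuit M C × C ⊆ F ∪ ⁅ e ⁆ × IsMinOf e C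

  Ext : Subset n → Fin n → Set
  Ext F e = Act F e × e ∉ F

  _≤Ext_ : Subset n → Subset n → Set
  A ≤Ext B = IsBasis M A × IsBasis M B × (∀ e → e ∈ A → e ∈ B ⊎ Ext B e)

  -- L(M): elements are  nothing  (the adjoined minimum 0̂) or  just B  with B a basis
  IsElemL : Maybe (Subset n) → Set
  IsElemL nothing  = ⊤
  IsElemL (just B) = IsBasis M B

  _≤L_ : Maybe (Subset n) → Maybe (Subset n) → Set
  nothing ≤L y      = IsElemL y
  just A  ≤L nothing = Empty.⊥
  just A  ≤L just B  = A ≤Ext B

{-# OPTIONS --safe #-}
-- The minimum of a circuit C, under any order, is active with respect to E
-- (witnessed by C itself). So if e is the ⊴-minimum and g the ⊴′-minimum of C,
-- both lie in the common set Act(E), where the orders agree: e ⊴ g gives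
-- e ⊴′ g, and with g ⊴′ e antisymmetry forces e = g. Hence every circuit has
-- the same minimum in both orders, Act(F) and Ext(F) do not depend on the
-- order for any F, and the two external orders coincide.
module Submission where

open import Defs
open import Level using (0ℓ)
open import Data.Nat using (ℕ)
open import Data.Fin using (Fin)
open import Data.Fin.Subset using (Subset; ⊤; _∈_; Nonempty)
open import Data.Fin.Subset.Properties using (_∈?_; ∈⊤; x∈p∪q⁺)
open import Data.List using (List; allFin; filter)
open import Data.List.Relation.Unary.All using (lookup)
open import Data.List.Relation.Unary.All.Properties using (all-filter)
open import Data.List.Membership.Propositional.Properties using (∈-allFin; ∈-filter⁺)
import Data.List.Extrema
open import Data.Maybe using (Maybe; just; nothing)
open import Data.Product using (∃; _×_; _,_)
open import Data.Sum using (inj₁; map₂)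
open import Function.Base using (id)
open import Function.Bundles using (_⇔_; mk⇔; Equivalence)
open import Relation.Binary.Bundles using (TotalOrder)
open import Relation.Binary.Structures using (IsTotalOrder)
open import Relation.Binary.PropositionalEquality using (_≡_; subst; sym)

LinOrder⇒TotalOrder : ∀ {n} → LinOrder n → TotalOrder 0ℓ 0ℓ 0ℓ
LinOrder⇒TotalOrder O = record { isTotalOrder = LinOrder.isTotalOrder O }

module _ {n : ℕ} (O : LinOrder n) where
  open LinOrder O
  open Data.List.Extrema (LinOrder⇒TotalOrder O) using (min; argmin-all; min≤xs)

  minimum : ∀ {C : Subset n} → Nonempty C → ∃ λ g → g ∈ C × (∀ f → f ∈ C → g ⊴ f)
  minimum {C} (e , e∈C) =
    min e members ,
    argmin-all id e∈C (all-filter (_∈? C) (allFin n)) ,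
    λ f f∈C → lookup (min≤xs e members) (∈-filter⁺ (_∈? C) (∈-allFin f) f∈C)
    where
    members : List (Fin n)
    members = filter (_∈? C) (allFin n)

module _ {n : ℕ} (M : Matroid n) (O : LinOrder n) where

  circuit-min⇒active : ∀ {C e} → IsCircuit M C → IsMinOf M O e C → Act M O ⊤ e
  circuit-min⇒active {C} circ e-min = C , circ , (λ _ → x∈p∪q⁺ (inj₁ ∈⊤)) , e-min

module Transfer {n : ℕ} (M : Matroid n) (O O′ : LinOrder n)
  (active′⇒active : ∀ e → Act M O′ ⊤ e → Act M O ⊤ e)
  (⊴⇒⊴′ : ∀ e f → Act M O ⊤ e → Act M O ⊤ f → LinOrder._⊴_ O e f → LinOrder._⊴_ O′ e f)
  where
  open LinOrder O′ renaming (_⊴_ to _⊴′_)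
  open IsTotalOrder isTotalOrder using (antisym)

  circuit-min-transfer : ∀ {C e} → IsCircuit M C → IsMinOf M O e C → IsMinOf M O′ e C
  circuit-min-transfer {C} {e} circ e-min@(e∈C , e≤C) with minimum O′ (e , e∈C)
  ... | g , g∈C , g≤′C = e∈C , λ f f∈C → subst (_⊴′ f) (sym e≡g) (g≤′C f f∈C)
    where
    g-active : Act M O ⊤ g
    g-active = active′⇒active g (circuit-min⇒active M O′ circ (g∈C , g≤′C))

    e≡g : e ≡ g
    e≡g = antisym (⊴⇒⊴′ e g (circuit-min⇒active M O circ e-min) g-active (e≤C g g∈C))
                  (g≤′C e e∈C)

  Act-transfer : ∀ {F e} → Act M O F e → Act M O′ F e
  Act-transfer (C , circ , C⊆F∪e , e-min) = C , circ , C⊆F∪e , circuit-min-transfer circ e-min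

  Ext-transfer : ∀ {F e} → Ext M O F e → Ext M O′ F e
  Ext-transfer (e-active , e∉F) = Act-transfer e-active , e∉F

  ≤L-transfer : ∀ x y → _≤L_ M O x y → _≤L_ M O′ x y
  ≤L-transfer nothing  nothing  _ = _
  ≤L-transfer nothing  (just B) B-basis = B-basis
  ≤L-transfer (just A) (just B) (A-basis , B-basis , A⊆B∪Ext) =
    A-basis , B-basis , λ e e∈A → map₂ Ext-transfer (A⊆B∪Ext e e∈A)

open Equivalence using (to; from)

proposition1p2 : ∀ {n : ℕ} (M : Matroid n) (O O′ : LinOrder n) →
    (∀ e → Act M O ⊤ e ⇔ Act M O′ ⊤ e) →
    (∀ e f → Act M O ⊤ e → Act M O ⊤ f → (LinOrder._⊴_ O e f ⇔ LinOrder._⊴_ O′ e f)) →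
    ∀ (x y : Maybe (Subset n)) → (_≤L_ M O x y ⇔ _≤L_ M O′ x y)
proposition1p2 M O O′ active⇔ ⊴⇔ x y =
  mk⇔ (Transfer.≤L-transfer M O O′ (λ e → from (active⇔ e)) ⊴⇒⊴′ x y)
      (Transfer.≤L-transfer M O′ O (λ e → to (active⇔ e)) ⊴′⇒⊴ x y)
  where
  ⊴⇒⊴′ : ∀ e f → Act M O ⊤ e → Act M O ⊤ f → LinOrder._⊴_ O e f → LinOrder._⊴_ O′ e f
  ⊴⇒⊴′ e f e-active f-active = to (⊴⇔ e f e-active f-active)

  ⊴′⇒⊴ : ∀ e f → Act M O′ ⊤ e → Act M O′ ⊤ f → LinOrder._⊴_ O′ e f → LinOrder._⊴_ O e f
  ⊴′⇒⊴ e f e-active′ f-active′ =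
    from (⊴⇔ e f (from (active⇔ e) e-active′) (from (active⇔ f) f-active′))
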